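{- Let $\mathbf{L}=\langle L,\leq\rangle$ be a complete algebraic lattice with $K$ its set of compact elements, let $S$ be a compact $L$-parameterization, and let $C\colon L\to L$ be an algebraic $S$-closure operator. Put $\Sigma_C=\{a\Rightarrow b;\ a,b\in K,\ b\leq C(a)\}$. Then $C=C_{\Sigma_C}$.
   Context: An isotone Galois connection in $\mathbf{L}$ is a pair $\langle f,h\rangle$ of maps $L\to L$ with $f(a)\leq b$ iff $a\leq h(b)$. An $L$-parameterization is a set $S$ of isotone Galois connections containing $\langle\mathrm{id},\mathrm{id}\rangle$; compact if $f(a)\in K$ whenever $a\in K$, $\langle f,h\rangle\in S$. An $S$-closure operator is $C\colon L\to L$ with $a\leq C(a)$, $a\leq b\Rightarrow C(a)\leq C(b)$, and $C(h(C(a)))\leq h(C(a))$ for all $a,b\in L$, $\langle f,h\rangle\in S$; it is algebraic if $C(a)=\bigvee\{C(c);\ c\in K, c\leq a\}$ for all $a\in L$. A formula is a pair $a\Rightarrow b$ with $a,b\in K$. $S$-inference rules, for $a,b,c,d\in K$, $\langle f,h\rangle\in S$: infer $a\vee b\Rightarrow b$; from $a\Rightarrow b$ and $b\vee c\Rightarrow d$ infer $a\vee c\Rightarrow d$; from $a\Rightarrow b$ infer $f(a)\Rightarrow f(b)$. $\Sigma\vdash a\Rightarrow b$ means existence of a finite proof from $\Sigma$ using these rules. $C_\Sigma(a)=\bigvee\{b\in K;\ \Sigma\vdash c\Rightarrow b$ for some $c\in K$, $c\leq a\}$. -}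

module Defs where

open import Level using (Level; suc)
open import Data.Product using (Σ; ∃; _×_; _,_; proj₁; proj₂)
open import Data.Sum using (_⊎_)
open import Data.List using (List)
open import Data.List.Relation.Unary.All using (All)
open import Data.List.Membership.Propositional using (_∈_)
open import Relation.Unary using (Pred)
open import Relation.Binary.PropositionalEquality using (_≡_)
open import Relation.Binary.Structures using (IsPartialOrder)
open import Function.Bundles using (_⇔_)

record CompleteLattice (ℓ : Level) : Set (suc ℓ) where
  field
    Carrier          : Set ℓ
    _≤_              : Carrier → Carrier → Set ℓ
    isPartialOrder   : IsPartialOrder _≡_ _≤_
    ⋁                : Pred Carrier ℓ → Carrier
    ⋁-upper          : ∀ (X : Pred Carrier ℓ) x → X x → x ≤ ⋁ X
    ⋁-least          : ∀ (X : Pred Carrier ℓ) y → (∀ x → X x → x ≤ y) → ⋁ X ≤ y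

  _∨_ : Carrier → Carrier → Carrier
  a ∨ b = ⋁ (λ y → (y ≡ a) ⊎ (y ≡ b))

  ⋁-list : List Carrier → Carrier
  ⋁-list xs = ⋁ (λ y → y ∈ xs)

  IsCompact : Carrier → Set (suc ℓ)
  IsCompact a = ∀ (X : Pred Carrier ℓ) → a ≤ ⋁ X →
    ∃ λ (ys : List Carrier) → All X ys × (a ≤ ⋁-list ys)

  IsCompactSet : Pred Carrier ℓ → Set (suc ℓ)
  IsCompactSet K = ∀ a → K a ⇔ IsCompact a

  IsAlgebraic : Pred Carrier ℓ → Set ℓ
  IsAlgebraic K = ∀ a → a ≡ ⋁ (λ c → K c × (c ≤ a))

module _ {ℓ : Level} (𝐋 : CompleteLattice ℓ) (K : Pred (CompleteLattice.Carrier 𝐋) ℓ) where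
  open CompleteLattice 𝐋

  record GaloisConnection : Set ℓ where
    field
      f : Carrier → Carrier
      h : Carrier → Carrier
      adj : ∀ a b → (f a ≤ b → a ≤ h b) × (a ≤ h b → f a ≤ b)
  open GaloisConnection public

  IsParameterization : Pred GaloisConnection ℓ → Set ℓ
  IsParameterization S =
    ∃ λ g → S g × ((∀ a → f g a ≡ a) × (∀ a → h g a ≡ a))

  IsCompactParameterization : Pred GaloisConnection ℓ → Set ℓ
  IsCompactParameterization S =
    IsParameterization S × (∀ g a → S g → K a → K (f g a))

  IsSClosure : Pred GaloisConnection ℓ → (Carrier → Carrier) → Set ℓ
  IsSClosure S C =
    (∀ a → a ≤ C a) ×
    (∀ a b → a ≤ b → C a ≤ C b) ×
    (∀ a g → S g → C (h g (C a)) ≤ h g (C a))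

  IsAlgebraicClosure : (Carrier → Carrier) → Set ℓ
  IsAlgebraicClosure C =
    ∀ a → C a ≡ ⋁ (λ y → ∃ λ c → K c × (c ≤ a) × (y ≡ C c))

  -- formulas a ⇒ b are pairs (a , b); compactness of a, b is required
  -- where formulas are built (in Σ_C and in the inference rules)
  Formula : Set ℓ
  Formula = Carrier × Carrier

  data Derivable (S : Pred GaloisConnection ℓ) (Σ' : Pred Formula ℓ) : Formula → Set ℓ where
    hyp  : ∀ {φ} → Σ' φ → Derivable S Σ' φ
    ax   : ∀ {a b} → K a → K b → Derivable S Σ' (a ∨ b , b)
    cut  : ∀ {a b c d} → K a → K b → K c → K d →
           Derivable S Σ' (a , b) → Derivable S Σ' (b ∨ c , d) →
           Derivable S Σ' (a ∨ c , d)
    subst : ∀ {g a b} → S g → K a → K b →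
           Derivable S Σ' (a , b) → Derivable S Σ' (f g a , f g b)

  closureOf : Pred GaloisConnection ℓ → Pred Formula ℓ → Carrier → Carrier
  closureOf S Σ' a =
    ⋁ (λ b → K b × ∃ λ c → K c × (c ≤ a) × Derivable S Σ' (c , b))

  theoryOf : (Carrier → Carrier) → Pred Formula ℓ
  theoryOf C (a , b) = K a × K b × (b ≤ C a)

-- Soundness: every rule of S-inference preserves "b ≤ C a", so derivations from
-- Σ_C yield nothing beyond C; this gives C_{Σ_C} ≤ C. Conversely, each compact
-- k ≤ C c with c compact is itself the formula c ⇒ k of Σ_C, and algebraicity of
-- L and of C writes C a as a join of such k with c ≤ a; this gives C ≤ C_{Σ_C}.
module Submission where

open import Defs
open import Level using (Level)
open import Relation.Unary using (Pred)
open import Relation.Binary.PropositionalEquality using (_≡_; refl; sym)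
open import Relation.Binary.Structures using (IsPartialOrder)
open import Data.Product using (_,_; proj₁; proj₂)
open import Data.Sum using (inj₁; inj₂)

module JoinProperties {ℓ : Level} (𝐋 : CompleteLattice ℓ) where
  open CompleteLattice 𝐋

  ∨-upperˡ : ∀ a b → a ≤ (a ∨ b)
  ∨-upperˡ a b = ⋁-upper _ a (inj₁ refl)

  ∨-upperʳ : ∀ a b → b ≤ (a ∨ b)
  ∨-upperʳ a b = ⋁-upper _ b (inj₂ refl)

  ∨-least : ∀ {a b c} → a ≤ c → b ≤ c → (a ∨ b) ≤ c
  ∨-least {c = c} a≤c b≤c = ⋁-least _ c λ { _ (inj₁ refl) → a≤c ; _ (inj₂ refl) → b≤c }

module GaloisProperties {ℓ : Level} {𝐋 : CompleteLattice ℓ}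
    {K : Pred (CompleteLattice.Carrier 𝐋) ℓ} (g : GaloisConnection 𝐋 K) where
  open CompleteLattice 𝐋
  open IsPartialOrder isPartialOrder renaming (refl to ≤-refl; trans to ≤-trans)

  ≤-h∘f : ∀ a → a ≤ h g (f g a)
  ≤-h∘f a = proj₁ (adj g a (f g a)) ≤-refl

  f-≤⇒≤-h : ∀ {a b} → f g a ≤ b → a ≤ h g b
  f-≤⇒≤-h {a} {b} = proj₁ (adj g a b)

  ≤-h⇒f-≤ : ∀ {a b} → a ≤ h g b → f g a ≤ b
  ≤-h⇒f-≤ {a} {b} = proj₂ (adj g a b)

  h-mono : ∀ {a b} → a ≤ b → h g a ≤ h g b
  h-mono a≤b = f-≤⇒≤-h (≤-trans (≤-h⇒f-≤ ≤-refl) a≤b)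

module SClosureProperties {ℓ : Level} {𝐋 : CompleteLattice ℓ}
    {K : Pred (CompleteLattice.Carrier 𝐋) ℓ} {S : Pred (GaloisConnection 𝐋 K) ℓ}
    (param : IsParameterization 𝐋 K S)
    {C : CompleteLattice.Carrier 𝐋 → CompleteLattice.Carrier 𝐋}
    (closure : IsSClosure 𝐋 K S C) where
  open CompleteLattice 𝐋
  open IsPartialOrder isPartialOrder renaming (refl to ≤-refl; trans to ≤-trans)
  open JoinProperties 𝐋

  extensive : ∀ a → a ≤ C a
  extensive = proj₁ closure

  monotone : ∀ {a b} → a ≤ b → C a ≤ C b
  monotone {a} {b} = proj₁ (proj₂ closure) a b

  closed-h : ∀ a {g} → S g → C (h g (C a)) ≤ h g (C a)
  closed-h a {g} = proj₂ (proj₂ closure) a g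

  -- Closedness under the identity connection ⟨id,id⟩ ∈ S.
  idempotent : ∀ a → C (C a) ≤ C a
  idempotent a = let g , g∈S , _ , h≗id = param in
    ≤-trans (≤-trans (monotone (reflexive (sym (h≗id (C a))))) (closed-h a g∈S)) (reflexive (h≗id (C a)))

  theoryOf-sound : ∀ {a b} → Derivable 𝐋 K S (theoryOf 𝐋 K C) (a , b) → b ≤ C a
  theoryOf-sound (hyp (_ , _ , b≤Ca)) = b≤Ca
  theoryOf-sound (ax {a} {b} _ _) = ≤-trans (∨-upperʳ a b) (extensive (a ∨ b))
  theoryOf-sound (cut {a} {b} {c} {d} _ _ _ _ a⇒b b∨c⇒d) =
    ≤-trans (theoryOf-sound b∨c⇒d) (≤-trans (monotone b∨c≤C[a∨c]) (idempotent (a ∨ c)))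
    where
      b∨c≤C[a∨c] : (b ∨ c) ≤ C (a ∨ c)
      b∨c≤C[a∨c] = ∨-least (≤-trans (theoryOf-sound a⇒b) (monotone (∨-upperˡ a c)))
                           (≤-trans (∨-upperʳ a c) (extensive (a ∨ c)))
  theoryOf-sound (subst {g} {a} {b} g∈S _ _ a⇒b) =
    ≤-h⇒f-≤ (≤-trans (theoryOf-sound a⇒b) (≤-trans (monotone a≤hCfa) (closed-h (f g a) g∈S)))
    where
      open GaloisProperties g
      a≤hCfa : a ≤ h g (C (f g a))
      a≤hCfa = ≤-trans (≤-h∘f a) (h-mono (extensive (f g a)))

  closureOf-theoryOf-≤ : ∀ a → closureOf 𝐋 K S (theoryOf 𝐋 K C) a ≤ C a
  closureOf-theoryOf-≤ a =
    ⋁-least _ (C a) λ { _ (_ , c , _ , c≤a , c⇒b) → ≤-trans (theoryOf-sound c⇒b) (monotone c≤a) }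

module _ {ℓ : Level} {𝐋 : CompleteLattice ℓ}
    {K : Pred (CompleteLattice.Carrier 𝐋) ℓ} (S : Pred (GaloisConnection 𝐋 K) ℓ)
    {C : CompleteLattice.Carrier 𝐋 → CompleteLattice.Carrier 𝐋} where
  open CompleteLattice 𝐋
  open IsPartialOrder isPartialOrder renaming (trans to ≤-trans)

  ≤-closureOf-theoryOf : IsAlgebraic K → IsAlgebraicClosure 𝐋 K C →
                         ∀ a → C a ≤ closureOf 𝐋 K S (theoryOf 𝐋 K C) a
  ≤-closureOf-theoryOf algebraic algebraicC a =
    ≤-trans (reflexive (algebraicC a)) (⋁-least _ _ λ { _ (c , Kc , c≤a , refl) → C-compact≤ c Kc c≤a })
    where
      C-compact≤ : ∀ c → K c → c ≤ a → C c ≤ closureOf 𝐋 K S (theoryOf 𝐋 K C) a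
      C-compact≤ c Kc c≤a = ≤-trans (reflexive (algebraic (C c)))
        (⋁-least _ _ λ { k (Kk , k≤Cc) → ⋁-upper _ k (Kk , c , Kc , c≤a , hyp (Kc , Kk , k≤Cc)) })

theorem19 : {ℓ : Level} (𝐋 : CompleteLattice ℓ)
    (K : Pred (CompleteLattice.Carrier 𝐋) ℓ) →
    CompleteLattice.IsCompactSet 𝐋 K →
    CompleteLattice.IsAlgebraic 𝐋 K →
    (S : Pred (GaloisConnection 𝐋 K) ℓ) →
    IsCompactParameterization 𝐋 K S →
    (C : CompleteLattice.Carrier 𝐋 → CompleteLattice.Carrier 𝐋) →
    IsSClosure 𝐋 K S C →
    IsAlgebraicClosure 𝐋 K C →
    ∀ a → C a ≡ closureOf 𝐋 K S (theoryOf 𝐋 K C) a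
theorem19 𝐋 K _ algebraic S (param , _) C closure algebraicC a =
  antisym (≤-closureOf-theoryOf S algebraic algebraicC a) (closureOf-theoryOf-≤ a)
  where
    open IsPartialOrder (CompleteLattice.isPartialOrder 𝐋) using (antisym)
    open SClosureProperties param closure
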